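{- Let $G(V, E)$ be a graph with $|V| = n$. Then $\mathrm{edim}(G) = n - 1 $ if and only if for any distinct $ v_1, v_2 \in V $ there exists $ u \in V $ such that $v_1u \in E, v_2u \in E$ and $u$ is adjacent to all non-mutual neighbors of $v_1, v_2$.
   Context: All graphs are simple, connected and undirected. For an edge $e=xy$ and a vertex $v$, $d(e,v)=\min\{d(x,v),d(y,v)\}$. A set $S\subseteq V$ is an edge metric generator if for any two distinct edges $e_1,e_2$ some $s\in S$ has $d(e_1,s)\neq d(e_2,s)$; $\mathrm{edim}(G)$ is the minimum size of an edge metric generator. $N(v)$ denotes the set of vertices adjacent to $v$ (not including $v$). The non-mutual neighbors of $v_1$ and $v_2$ are the vertices of $(N(v_1)\cup N(v_2))\setminus(N(v_1)\cap N(v_2))$. -}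

module Defs where

open import Data.Nat using (ℕ; zero; suc; _≤_; _⊓_)
open import Data.Fin using (Fin)
open import Data.Fin.Subset using (Subset; _∈_; ∣_∣)
open import Data.Product using (Σ; ∃; ∃-syntax; _×_; _,_)
open import Data.Sum using (_⊎_)
open import Relation.Nullary using (¬_; Dec)
open import Relation.Binary.PropositionalEquality using (_≡_; _≢_)

record Graph (n : ℕ) : Set₁ where
  field
    Adj     : Fin n → Fin n → Set
    adj?    : ∀ x y → Dec (Adj x y)
    sym     : ∀ {x y} → Adj x y → Adj y x
    irrefl  : ∀ {x} → ¬ Adj x x
open Graph public

data Walk {n : ℕ} (G : Graph n) : Fin n → Fin n → ℕ → Set where
  here : ∀ {x} → Walk G x x zero
  step : ∀ {x y z k} → Adj G x y → Walk G y z k → Walk G x z (suc k)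

Connected : ∀ {n} → Graph n → Set
Connected G = ∀ x y → ∃[ k ] Walk G x y k

Dist : ∀ {n} → Graph n → Fin n → Fin n → ℕ → Set
Dist G x y k = Walk G x y k × (∀ m → Walk G x y m → k ≤ m)

Edge : ∀ {n} → Graph n → Set
Edge {n} G = Σ (Fin n) λ x → Σ (Fin n) λ y → Adj G x y

SameEdge : ∀ {n} {G : Graph n} → Edge G → Edge G → Set
SameEdge (x₁ , y₁ , _) (x₂ , y₂ , _) =
  (x₁ ≡ x₂ × y₁ ≡ y₂) ⊎ (x₁ ≡ y₂ × y₁ ≡ x₂)

EdgeDist : ∀ {n} (G : Graph n) → Edge G → Fin n → ℕ → Set
EdgeDist G (x , y , _) v k =
  ∃[ a ] ∃[ b ] (Dist G x v a × Dist G y v b × k ≡ a ⊓ b)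

Distinguishes : ∀ {n} (G : Graph n) → Fin n → Edge G → Edge G → Set
Distinguishes G s e₁ e₂ =
  ∀ k₁ k₂ → EdgeDist G e₁ s k₁ → EdgeDist G e₂ s k₂ → k₁ ≢ k₂

IsEdgeMetricGenerator : ∀ {n} (G : Graph n) → Subset n → Set
IsEdgeMetricGenerator G S =
  ∀ (e₁ e₂ : Edge G) → ¬ SameEdge {G = G} e₁ e₂ →
  ∃[ s ] (s ∈ S × Distinguishes G s e₁ e₂)

EdimIs : ∀ {n} → Graph n → ℕ → Set
EdimIs {n} G k =
  (∃[ S ] (IsEdgeMetricGenerator G S × ∣ S ∣ ≡ k)) ×
  (∀ S → IsEdgeMetricGenerator G S → k ≤ ∣ S ∣)

NonMutualNeighbour : ∀ {n} (G : Graph n) → Fin n → Fin n → Fin n → Set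
NonMutualNeighbour G v₁ v₂ w =
  (Adj G v₁ w ⊎ Adj G v₂ w) × ¬ (Adj G v₁ w × Adj G v₂ w)

module Submission where

-- Call u a hub of v₁ ≠ v₂ if u is a common neighbour of v₁, v₂ that is
-- adjacent to every non-mutual neighbour of v₁, v₂.  The proof rests on
-- three facts about edge distances d(e,s):
--
--  * V ∖ {v} is always an edge metric generator: two different edges have
--    an endpoint p of one that is not on the other, p is then at distance
--    0 from one edge and at distance ≥ 1 from the other, and if p = v the
--    other edge has such an endpoint too.  Hence edim(G) ≤ n − 1.
--  * If v₁, v₂ have no hub, then V ∖ {v₁, v₂} is still a generator.  The
--    only pairs of edges left to separate are v₁r, v₂r with r a common
--    neighbour; as r is not a hub, some non-mutual neighbour w of v₁, v₂
--    is not adjacent to r, and w is at distance ≤ 1 from one edge but ≥ 2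
--    from the other.  Hence edim(G) ≤ n − 2.
--  * If u is a hub of v₁, v₂, then every s ∉ {v₁, v₂} has
--    d(v₁u, s) = d(v₂u, s), so every generator meets {v₁, v₂}.  If all
--    pairs have hubs, a generator misses at most one vertex: edim(G) ≥ n − 1.
--
-- Since having a hub is decidable, the theorem follows constructively.

open import Defs
open import Data.Nat using (ℕ; _∸_)
open import Data.Fin using (Fin)
open import Data.Product using (∃-syntax; _×_)
open import Relation.Binary.PropositionalEquality using (_≢_)
open import Function.Bundles using (_⇔_)

open import Data.Nat using (zero; suc; _≤_; _<_; z≤n; s≤s; _⊓_; _≤?_; _<?_)
open import Data.Nat.Properties
open import Data.Fin using (zero; suc)
open import Data.Fin.Properties using (any?; all?; ¬∀⟶∃¬) renaming (_≟_ to _≟ᶠ_)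
open import Data.Fin.Subset using (Subset; _∈_; _∉_; ∣_∣; ⁅_⁆; ∁; _∪_; ⊥)
open import Data.Fin.Subset.Properties
open import Data.Product using (_,_; proj₁; proj₂)
open import Data.Sum using (_⊎_; inj₁; inj₂; [_,_]; swap)
open import Data.Empty using (⊥-elim)
open import Relation.Nullary using (¬_; Dec; yes; no)
open import Relation.Nullary.Decidable.Core using (_×-dec_; _⊎-dec_; _→-dec_; ¬?)
open import Relation.Binary.PropositionalEquality
  using (_≡_; refl; cong; trans; subst; ≢-sym) renaming (sym to ≡-sym)
open import Function.Bundles using (mk⇔)

least-up-to : (P : ℕ → Set) → (∀ k → Dec (P k)) → ∀ k →
  (∃[ m ] (P m × (∀ j → P j → m ≤ j))) ⊎ (∀ j → j ≤ k → ¬ P j)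
least-up-to P P? zero with P? zero
... | yes p = inj₁ (0 , p , λ _ _ → z≤n)
... | no ¬p = inj₂ λ { zero _ → ¬p ; (suc j) () }
least-up-to P P? (suc k) with least-up-to P P? k
... | inj₁ least = inj₁ least
... | inj₂ none-below with P? (suc k)
...   | yes p = inj₁ (suc k , p , λ j pj → ≰⇒> (λ j≤k → none-below j j≤k pj))
...   | no ¬p = inj₂ λ j j≤1+k →
          [ (λ j<1+k → none-below j (≤-pred j<1+k)) , (λ { refl → ¬p }) ]
            (m≤n⇒m<n∨m≡n j≤1+k)

least-witness : (P : ℕ → Set) → (∀ k → Dec (P k)) → ∀ {k} → P k →
  ∃[ m ] (P m × (∀ j → P j → m ≤ j))
least-witness P P? {k} p with least-up-to P P? k
... | inj₁ least = least
... | inj₂ none = ⊥-elim (none k ≤-refl p)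

-- a ⊓ c = b ⊓ c as soon as each of a, b that lies below c is dominated by
-- the other.  This is how two edges through a common vertex get equal distances.
⊓-agree : ∀ {a b c} → (a < c → b ≤ a) → (b < c → a ≤ b) → a ⊓ c ≡ b ⊓ c
⊓-agree {a} {b} {c} a<c⇒b≤a b<c⇒a≤b with a <? c
... | yes a<c = cong (_⊓ c) (≤-antisym (b<c⇒a≤b (≤-<-trans b≤a a<c)) b≤a)
  where b≤a = a<c⇒b≤a a<c
... | no a≮c with b <? c
...   | yes b<c = ⊥-elim (a≮c (≤-<-trans (b<c⇒a≤b b<c) b<c))
...   | no b≮c = trans (m≥n⇒m⊓n≡n (≮⇒≥ a≮c)) (≡-sym (m≥n⇒m⊓n≡n (≮⇒≥ b≮c)))

∣∁⁅v⁆∣≡n∸1 : ∀ {n} (v : Fin n) → ∣ ∁ ⁅ v ⁆ ∣ ≡ n ∸ 1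
∣∁⁅v⁆∣≡n∸1 {n} v = trans (∣∁p∣≡n∸∣p∣ ⁅ v ⁆) (cong (n ∸_) (∣⁅x⁆∣≡1 v))

outside-both : ∀ {n} (T S : Subset n) → ¬ (∣ ∁ T ∣ ≤ ∣ S ∣) → ∃[ v ] (v ∉ T × v ∉ S)
outside-both {n} T S small
  with ¬∀⟶∃¬ n (λ v → v ∈ T ⊎ v ∈ S) (λ v → (v ∈? T) ⊎-dec (v ∈? S))
         (λ covered → small (p⊆q⇒∣p∣≤∣q∣ {p = ∁ T} {q = S} (λ {v} v∈∁T →
            [ (λ v∈T → ⊥-elim (x∈∁p⇒x∉p v∈∁T v∈T)) , (λ v∈S → v∈S) ] (covered v))))
... | v , v∉T∪S = v , (λ v∈T → v∉T∪S (inj₁ v∈T)) , (λ v∈S → v∉T∪S (inj₂ v∈S))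

misses-two : ∀ {n} (S : Subset n) → ¬ (n ∸ 1 ≤ ∣ S ∣) →
  ∃[ v₁ ] ∃[ v₂ ] (v₁ ≢ v₂ × v₁ ∉ S × v₂ ∉ S)
misses-two {n} S small
  with outside-both (⊥ {n = n}) S (λ le → small (≤-trans (m∸n≤m n 1)
         (subst (_≤ ∣ S ∣) (trans (∣∁p∣≡n∸∣p∣ (⊥ {n = n})) (cong (n ∸_) (∣⊥∣≡0 n))) le)))
... | v₁ , _ , v₁∉S
  with outside-both ⁅ v₁ ⁆ S (λ le → small (subst (_≤ ∣ S ∣) (∣∁⁅v⁆∣≡n∸1 v₁) le))
... | v₂ , v₂∉⁅v₁⁆ , v₂∉S = v₁ , v₂ , (λ v₁≡v₂ → x∉⁅y⁆⇒x≢y v₂∉⁅v₁⁆ (≡-sym v₁≡v₂)) , v₁∉S , v₂∉S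

-- V ∖ {v₁, v₂} has fewer than n − 1 elements: it is a proper subset of V ∖ {v₁}.
∣∁⁅v₁,v₂⁆∣<n∸1 : ∀ {n} {v₁ v₂ : Fin n} → v₁ ≢ v₂ → ∣ ∁ (⁅ v₁ ⁆ ∪ ⁅ v₂ ⁆) ∣ < n ∸ 1
∣∁⁅v₁,v₂⁆∣<n∸1 {v₁ = v₁} {v₂} v₁≢v₂ = subst (∣ ∁ (⁅ v₁ ⁆ ∪ ⁅ v₂ ⁆) ∣ <_) (∣∁⁅v⁆∣≡n∸1 v₁)
  (p⊂q⇒∣p∣<∣q∣
    ( (λ v∈ → x∉p⇒x∈∁p (λ v∈⁅v₁⁆ → x∈∁p⇒x∉p v∈ (x∈p∪q⁺ (inj₁ v∈⁅v₁⁆))))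
    , v₂ , x∉p⇒x∈∁p (x≢y⇒x∉⁅y⁆ (λ v₂≡v₁ → v₁≢v₂ (≡-sym v₂≡v₁)))
    , (λ v₂∈ → x∈∁p⇒x∉p v₂∈ (x∈p∪q⁺ (inj₂ (x∈⁅x⁆ v₂)))) ))

module _ {n : ℕ} (G : Graph n) where

  walk? : ∀ m x y → Dec (Walk G x y m)
  walk? zero x y with x ≟ᶠ y
  ... | yes refl = yes here
  ... | no x≢y = no λ { here → x≢y refl }
  walk? (suc m) x y with any? (λ z → adj? G x z ×-dec walk? m z y)
  ... | yes (z , x~z , walk) = yes (step x~z walk)
  ... | no none = no λ { (step {y = z} x~z walk) → none (z , x~z , walk) }

  distance : Connected G → ∀ x y → ∃[ k ] Dist G x y k
  distance connected x y =
    least-witness (Walk G x y) (λ m → walk? m x y) (proj₂ (connected x y))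

  walk₀⇒≡ : ∀ {x y} → Walk G x y 0 → x ≡ y
  walk₀⇒≡ here = refl

  walk₁⇒adj : ∀ {x y} → Walk G x y 1 → Adj G x y
  walk₁⇒adj (step x~y here) = x~y

  dist-self : ∀ {x a} → Dist G x x a → a ≤ 0
  dist-self (_ , shortest) = shortest 0 here

  dist-distinct : ∀ {x s a} → Dist G x s a → x ≢ s → 1 ≤ a
  dist-distinct {a = zero} (walk , _) x≢s = ⊥-elim (x≢s (walk₀⇒≡ walk))
  dist-distinct {a = suc a} _ _ = s≤s z≤n

  dist-adjacent : ∀ {x s a} → Dist G x s a → Adj G x s → a ≤ 1
  dist-adjacent (_ , shortest) x~s = shortest 1 (step x~s here)

  Far : Fin n → Fin n → Set
  Far w z = z ≢ w × ¬ Adj G z w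

  dist-far : ∀ {x s a} → Dist G x s a → Far s x → 2 ≤ a
  dist-far {a = zero} (walk , _) (x≢s , _) = ⊥-elim (x≢s (walk₀⇒≡ walk))
  dist-far {a = suc zero} (walk , _) (_ , x≁s) = ⊥-elim (x≁s (walk₁⇒adj walk))
  dist-far {a = suc (suc a)} _ _ = s≤s (s≤s z≤n)

  far-from-non-neighbour : ∀ {z w c} → ¬ Adj G z w → Adj G c z → ¬ Adj G c w → Far w z
  far-from-non-neighbour z≁w c~z c≁w = (λ z≡w → c≁w (subst (Adj G _) z≡w c~z)) , z≁w

  _∈ᵉ_ : Fin n → Edge G → Set
  s ∈ᵉ (x , y , _) = s ≡ x ⊎ s ≡ y

  _∉ᵉ_ : Fin n → Edge G → Set
  s ∉ᵉ e = ¬ (s ∈ᵉ e)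

  _∈ᵉ?_ : ∀ s e → Dec (s ∈ᵉ e)
  s ∈ᵉ? (x , y , _) = (s ≟ᶠ x) ⊎-dec (s ≟ᶠ y)

  edge-dist-endpoint : ∀ {s k} e → s ∈ᵉ e → EdgeDist G e s k → k ≤ 0
  edge-dist-endpoint _ (inj₁ refl) (a , b , Dx , _ , refl) = ≤-trans (m⊓n≤m a b) (dist-self Dx)
  edge-dist-endpoint _ (inj₂ refl) (a , b , _ , Dy , refl) = ≤-trans (m⊓n≤n a b) (dist-self Dy)

  edge-dist-off : ∀ {s k} e → s ∉ᵉ e → EdgeDist G e s k → 1 ≤ k
  edge-dist-off _ s∉e (a , b , Dx , Dy , refl) =
    ⊓-glb (dist-distinct Dx (λ x≡s → s∉e (inj₁ (≡-sym x≡s))))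
          (dist-distinct Dy (λ y≡s → s∉e (inj₂ (≡-sym y≡s))))

  edge-dist-near : ∀ {v w k} e → v ∈ᵉ e → Adj G v w → EdgeDist G e w k → k ≤ 1
  edge-dist-near _ (inj₁ refl) v~w (a , b , Dx , _ , refl) = ≤-trans (m⊓n≤m a b) (dist-adjacent Dx v~w)
  edge-dist-near _ (inj₂ refl) v~w (a , b , _ , Dy , refl) = ≤-trans (m⊓n≤n a b) (dist-adjacent Dy v~w)

  edge-dist-far : ∀ {w k} e → (∀ z → z ∈ᵉ e → Far w z) → EdgeDist G e w k → 2 ≤ k
  edge-dist-far (x , y , _) far (a , b , Dx , Dy , refl) =
    ⊓-glb (dist-far Dx (far x (inj₁ refl))) (dist-far Dy (far y (inj₂ refl)))

  separates : ∀ {s} m e₁ e₂ → (∀ {k} → EdgeDist G e₁ s k → k ≤ m) →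
    (∀ {k} → EdgeDist G e₂ s k → suc m ≤ k) → Distinguishes G s e₁ e₂
  separates m e₁ e₂ below above k₁ k₂ D₁ D₂ refl = 1+n≰n (≤-trans (above D₂) (below D₁))

  distinguishes-sym : ∀ {s} e₁ e₂ → Distinguishes G s e₂ e₁ → Distinguishes G s e₁ e₂
  distinguishes-sym _ _ dist k₁ k₂ D₁ D₂ k₁≡k₂ = dist k₂ k₁ D₂ D₁ (≡-sym k₁≡k₂)

  private-endpoint-distinguishes : ∀ {s} e₁ e₂ → s ∈ᵉ e₁ → s ∉ᵉ e₂ → Distinguishes G s e₁ e₂
  private-endpoint-distinguishes e₁ e₂ s∈e₁ s∉e₂ =
    separates 0 e₁ e₂ (edge-dist-endpoint e₁ s∈e₁) (edge-dist-off e₂ s∉e₂)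

  same-edge-sym : ∀ e₁ e₂ → SameEdge {G = G} e₁ e₂ → SameEdge {G = G} e₂ e₁
  same-edge-sym _ _ (inj₁ (p , q)) = inj₁ (≡-sym p , ≡-sym q)
  same-edge-sym _ _ (inj₂ (p , q)) = inj₂ (≡-sym q , ≡-sym p)

  private-endpoint : ∀ e₁ e₂ → ¬ SameEdge {G = G} e₁ e₂ → ∃[ p ] (p ∈ᵉ e₁ × p ∉ᵉ e₂)
  private-endpoint (x₁ , y₁ , x₁~y₁) e₂ different with x₁ ∈ᵉ? e₂ | y₁ ∈ᵉ? e₂
  ... | no x₁∉e₂ | _ = x₁ , inj₁ refl , x₁∉e₂
  ... | yes _ | no y₁∉e₂ = y₁ , inj₂ refl , y₁∉e₂
  ... | yes (inj₁ refl) | yes (inj₁ refl) = ⊥-elim (irrefl G x₁~y₁)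
  ... | yes (inj₁ refl) | yes (inj₂ refl) = ⊥-elim (different (inj₁ (refl , refl)))
  ... | yes (inj₂ refl) | yes (inj₁ refl) = ⊥-elim (different (inj₂ (refl , refl)))
  ... | yes (inj₂ refl) | yes (inj₂ refl) = ⊥-elim (irrefl G x₁~y₁)

  other-endpoint : ∀ {v} e → v ∈ᵉ e →
    ∃[ r ] (Adj G v r × r ∈ᵉ e × (∀ s → s ∈ᵉ e → s ≡ v ⊎ s ≡ r))
  other-endpoint (x , y , x~y) (inj₁ refl) = y , x~y , inj₂ refl , (λ _ s∈e → s∈e)
  other-endpoint (x , y , x~y) (inj₂ refl) = x , sym G x~y , inj₁ refl , (λ _ s∈e → swap s∈e)

  all-but-one-generates : ∀ v → IsEdgeMetricGenerator G (∁ ⁅ v ⁆)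
  all-but-one-generates v e₁ e₂ different
    with private-endpoint e₁ e₂ different
       | private-endpoint e₂ e₁ (λ same → different (same-edge-sym e₂ e₁ same))
  ... | p , p∈e₁ , p∉e₂ | q , q∈e₂ , q∉e₁ with p ≟ᶠ v
  ... | no p≢v = p , x∉p⇒x∈∁p (x≢y⇒x∉⁅y⁆ p≢v) , private-endpoint-distinguishes e₁ e₂ p∈e₁ p∉e₂
  ... | yes refl = q , x∉p⇒x∈∁p (x≢y⇒x∉⁅y⁆ (λ { refl → p∉e₂ q∈e₂ }))
                 , distinguishes-sym e₁ e₂ (private-endpoint-distinguishes e₂ e₁ q∈e₂ q∉e₁)

  Dominates : Fin n → Fin n → Fin n → Set
  Dominates u v₁ v₂ = ∀ w → NonMutualNeighbour G v₁ v₂ w → Adj G u w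

  Hub : Fin n → Fin n → Set
  Hub v₁ v₂ = ∃[ u ] (Adj G v₁ u × Adj G v₂ u × Dominates u v₁ v₂)

  non-mutual? : ∀ v₁ v₂ w → Dec (NonMutualNeighbour G v₁ v₂ w)
  non-mutual? v₁ v₂ w =
    (adj? G v₁ w ⊎-dec adj? G v₂ w) ×-dec ¬? (adj? G v₁ w ×-dec adj? G v₂ w)

  dominates? : ∀ u v₁ v₂ → Dec (Dominates u v₁ v₂)
  dominates? u v₁ v₂ = all? (λ w → non-mutual? v₁ v₂ w →-dec adj? G u w)

  hub? : ∀ v₁ v₂ → Dec (Hub v₁ v₂)
  hub? v₁ v₂ = any? (λ u → adj? G v₁ u ×-dec (adj? G v₂ u ×-dec dominates? u v₁ v₂))

  non-mutual-sym : ∀ {v₁ v₂ w} → NonMutualNeighbour G v₂ v₁ w → NonMutualNeighbour G v₁ v₂ w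
  non-mutual-sym (one , not-both) = swap one , λ (a , b) → not-both (b , a)

  undominated : ∀ {u v₁ v₂} → ¬ Dominates u v₁ v₂ →
    ∃[ w ] (NonMutualNeighbour G v₁ v₂ w × ¬ Adj G u w)
  undominated {u} {v₁} {v₂} ¬dom
    with ¬∀⟶∃¬ n _ (λ w → non-mutual? v₁ v₂ w →-dec adj? G u w) ¬dom
  ... | w , ¬[nm→u~w] with non-mutual? v₁ v₂ w
  ...   | yes nm = w , nm , λ u~w → ¬[nm→u~w] (λ _ → u~w)
  ...   | no ¬nm = ⊥-elim (¬[nm→u~w] (λ nm → ⊥-elim (¬nm nm)))

  Avoids : Fin n → Fin n → Fin n → Set
  Avoids v₁ v₂ s = s ≢ v₁ × s ≢ v₂

  near-versus-far : ∀ {v₁ v₂ r w} → Adj G v₁ w → Adj G v₂ r → ¬ Adj G v₂ w → ¬ Adj G r w →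
    ∀ e₁ e₂ → v₁ ∈ᵉ e₁ → (∀ z → z ∈ᵉ e₂ → z ≡ v₂ ⊎ z ≡ r) →
    Avoids v₁ v₂ w × Distinguishes G w e₁ e₂
  near-versus-far {v₁} {v₂} {r} {w} v₁~w v₂~r v₂≁w r≁w e₁ e₂ v₁∈e₁ e₂⊆v₂r =
    ( (λ { refl → irrefl G v₁~w }) , (λ w≡v₂ → proj₁ v₂-far (≡-sym w≡v₂)) )
    , separates 1 e₁ e₂ (edge-dist-near e₁ v₁∈e₁ v₁~w)
        (edge-dist-far e₂ λ z z∈e₂ → [ (λ { refl → v₂-far }) , (λ { refl → r-far }) ] (e₂⊆v₂r z z∈e₂))
    where
    v₂-far : Far w v₂
    v₂-far = far-from-non-neighbour v₂≁w (sym G v₂~r) r≁w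
    r-far : Far w r
    r-far = far-from-non-neighbour r≁w v₂~r v₂≁w

  no-hub-separates : ∀ {v₁ v₂} → ¬ Hub v₁ v₂ → ∀ e₁ e₂ →
    v₁ ∈ᵉ e₁ → v₁ ∉ᵉ e₂ → v₂ ∈ᵉ e₂ → v₂ ∉ᵉ e₁ →
    ∃[ s ] (Avoids v₁ v₂ s × Distinguishes G s e₁ e₂)
  no-hub-separates {v₁} {v₂} no-hub e₁ e₂ v₁∈e₁ v₁∉e₂ v₂∈e₂ v₂∉e₁
    with other-endpoint e₁ v₁∈e₁ | other-endpoint e₂ v₂∈e₂
  ... | r , v₁~r , r∈e₁ , e₁⊆v₁r | t , v₂~t , t∈e₂ , e₂⊆v₂t with r ∈ᵉ? e₂ | t ∈ᵉ? e₁
  ... | no r∉e₂ | _ =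
    r , ((λ { refl → irrefl G v₁~r }) , (λ { refl → v₂∉e₁ r∈e₁ }))
      , private-endpoint-distinguishes e₁ e₂ r∈e₁ r∉e₂
  ... | yes _ | no t∉e₁ =
    t , ((λ { refl → v₁∉e₂ t∈e₂ }) , (λ { refl → irrefl G v₂~t }))
      , distinguishes-sym e₁ e₂ (private-endpoint-distinguishes e₂ e₁ t∈e₂ t∉e₁)
  ... | yes r∈e₂ | yes _ with e₂⊆v₂t r r∈e₂
  ...   | inj₁ refl = ⊥-elim (v₂∉e₁ r∈e₁)
  ...   | inj₂ refl with undominated (λ dom → no-hub (r , v₁~r , v₂~t , dom))
  ...     | w , (inj₁ v₁~w , not-both) , r≁w =
            w , near-versus-far v₁~w v₂~t (λ v₂~w → not-both (v₁~w , v₂~w)) r≁w e₁ e₂ v₁∈e₁ e₂⊆v₂t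
  ...     | w , (inj₂ v₂~w , not-both) , r≁w =
            let (w≢v₂ , w≢v₁) , dist =
                  near-versus-far v₂~w v₁~r (λ v₁~w → not-both (v₁~w , v₂~w)) r≁w e₂ e₁ v₂∈e₂ e₁⊆v₁r
            in w , (w≢v₁ , w≢v₂) , distinguishes-sym e₁ e₂ dist

  avoids⇒∈∁ : ∀ {v₁ v₂ s} → Avoids v₁ v₂ s → s ∈ ∁ (⁅ v₁ ⁆ ∪ ⁅ v₂ ⁆)
  avoids⇒∈∁ {v₁} {v₂} (s≢v₁ , s≢v₂) = x∉p⇒x∈∁p λ s∈ →
    [ (λ s∈⁅v₁⁆ → s≢v₁ (x∈⁅y⁆⇒x≡y v₁ s∈⁅v₁⁆)) , (λ s∈⁅v₂⁆ → s≢v₂ (x∈⁅y⁆⇒x≡y v₂ s∈⁅v₂⁆)) ]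
      (x∈p∪q⁻ ⁅ v₁ ⁆ ⁅ v₂ ⁆ s∈)

  avoids-or-hits : ∀ v₁ v₂ s → Avoids v₁ v₂ s ⊎ (s ≡ v₁ ⊎ s ≡ v₂)
  avoids-or-hits v₁ v₂ s with s ≟ᶠ v₁ | s ≟ᶠ v₂
  ... | no s≢v₁ | no s≢v₂ = inj₁ (s≢v₁ , s≢v₂)
  ... | yes s≡v₁ | _ = inj₂ (inj₁ s≡v₁)
  ... | no _ | yes s≡v₂ = inj₂ (inj₂ s≡v₂)

  -- If v₁, v₂ have no hub, V ∖ {v₁, v₂} is an edge metric generator: a private
  -- endpoint of either edge avoiding v₁, v₂ distinguishes them, and otherwise the
  -- private endpoints are v₁ and v₂ themselves.
  no-hub-generates : ∀ {v₁ v₂} → ¬ Hub v₁ v₂ → IsEdgeMetricGenerator G (∁ (⁅ v₁ ⁆ ∪ ⁅ v₂ ⁆))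
  no-hub-generates {v₁} {v₂} no-hub e₁ e₂ different
    with private-endpoint e₁ e₂ different
       | private-endpoint e₂ e₁ (λ same → different (same-edge-sym e₂ e₁ same))
  ... | p , p∈e₁ , p∉e₂ | q , q∈e₂ , q∉e₁ with avoids-or-hits v₁ v₂ p | avoids-or-hits v₁ v₂ q
  ... | inj₁ p-avoids | _ =
    p , avoids⇒∈∁ p-avoids , private-endpoint-distinguishes e₁ e₂ p∈e₁ p∉e₂
  ... | inj₂ _ | inj₁ q-avoids =
    q , avoids⇒∈∁ q-avoids , distinguishes-sym e₁ e₂ (private-endpoint-distinguishes e₂ e₁ q∈e₂ q∉e₁)
  ... | inj₂ (inj₁ refl) | inj₂ (inj₁ refl) = ⊥-elim (p∉e₂ q∈e₂)
  ... | inj₂ (inj₂ refl) | inj₂ (inj₂ refl) = ⊥-elim (p∉e₂ q∈e₂)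
  ... | inj₂ (inj₁ refl) | inj₂ (inj₂ refl) =
    let s , avoids , dist = no-hub-separates no-hub e₁ e₂ p∈e₁ p∉e₂ q∈e₂ q∉e₁
    in s , avoids⇒∈∁ avoids , dist
  ... | inj₂ (inj₂ refl) | inj₂ (inj₁ refl) =
    let s , avoids , dist = no-hub-separates no-hub e₂ e₁ q∈e₂ q∉e₁ p∈e₁ p∉e₂
    in s , avoids⇒∈∁ avoids , distinguishes-sym e₁ e₂ dist

  -- If u dominates the non-mutual neighbours of v₁, v₂ and s ≠ v₁ is closer to
  -- v₁ than to u, then it is at least as close to v₂: a shortest walk from v₁
  -- leaves through a neighbour w, and w is adjacent to v₂ or (being a non-mutual
  -- neighbour) to u.
  closer-than-hub : ∀ {v₁ v₂ u s d₁ d₂ dᵤ} → Dominates u v₁ v₂ →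
    Dist G v₁ s d₁ → Dist G v₂ s d₂ → Dist G u s dᵤ → v₁ ≢ s → d₁ < dᵤ → d₂ ≤ d₁
  closer-than-hub {d₁ = zero} _ (walk , _) _ _ v₁≢s _ = ⊥-elim (v₁≢s (walk₀⇒≡ walk))
  closer-than-hub {v₂ = v₂} {u} {d₁ = suc d} dom (step {y = w} v₁~w rest , _) (_ , shortest₂) (_ , shortestᵤ) _ d₁<dᵤ
    with adj? G v₂ w
  ... | yes v₂~w = shortest₂ (suc d) (step v₂~w rest)
  ... | no v₂≁w = ⊥-elim (<⇒≱ d₁<dᵤ (shortestᵤ (suc d) (step u~w rest)))
    where
    u~w : Adj G u w
    u~w = dom w (inj₁ v₁~w , λ (_ , v₂~w) → v₂≁w v₂~w)

  -- With a hub u of v₁, v₂, no vertex other than v₁, v₂ distinguishes v₁u from v₂u: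
  -- d(v₁u, s) = min(d(v₁,s), d(u,s)) = min(d(v₂,s), d(u,s)) = d(v₂u, s).
  hub-twin-edges : Connected G → ∀ {v₁ v₂ u s} (v₁~u : Adj G v₁ u) (v₂~u : Adj G v₂ u) →
    Dominates u v₁ v₂ → Avoids v₁ v₂ s → ¬ Distinguishes G s (v₁ , u , v₁~u) (v₂ , u , v₂~u)
  hub-twin-edges connected {v₁} {v₂} {u} {s} v₁~u v₂~u dom (s≢v₁ , s≢v₂) distinguishes
    with distance connected v₁ s | distance connected v₂ s | distance connected u s
  ... | d₁ , D₁ | d₂ , D₂ | dᵤ , Dᵤ =
    distinguishes (d₁ ⊓ dᵤ) (d₂ ⊓ dᵤ) (d₁ , dᵤ , D₁ , Dᵤ , refl) (d₂ , dᵤ , D₂ , Dᵤ , refl)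
      (⊓-agree (closer-than-hub dom D₁ D₂ Dᵤ (≢-sym s≢v₁))
               (closer-than-hub (λ w nm → dom w (non-mutual-sym nm)) D₂ D₁ Dᵤ (≢-sym s≢v₂)))

  spokes-differ : ∀ {v₁ v₂ u} (v₁~u : Adj G v₁ u) (v₂~u : Adj G v₂ u) → v₁ ≢ v₂ →
    ¬ SameEdge {G = G} (v₁ , u , v₁~u) (v₂ , u , v₂~u)
  spokes-differ _ _ v₁≢v₂ (inj₁ (v₁≡v₂ , _)) = v₁≢v₂ v₁≡v₂
  spokes-differ v₁~u _ _ (inj₂ (refl , _)) = irrefl G v₁~u

  -- If every pair of distinct vertices has a hub, a generator misses at most one
  -- vertex, so it has at least n − 1 elements.
  all-hubs⇒lower-bound : Connected G → (∀ v₁ v₂ → v₁ ≢ v₂ → Hub v₁ v₂) →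
    ∀ S → IsEdgeMetricGenerator G S → n ∸ 1 ≤ ∣ S ∣
  all-hubs⇒lower-bound connected hubs S generates with n ∸ 1 ≤? ∣ S ∣
  ... | yes large = large
  ... | no small with misses-two S small
  ... | v₁ , v₂ , v₁≢v₂ , v₁∉S , v₂∉S with hubs v₁ v₂ v₁≢v₂
  ... | u , v₁~u , v₂~u , dom
    with generates (v₁ , u , v₁~u) (v₂ , u , v₂~u) (spokes-differ v₁~u v₂~u v₁≢v₂)
  ... | s , s∈S , distinguishes = ⊥-elim (hub-twin-edges connected v₁~u v₂~u dom
          ((λ { refl → v₁∉S s∈S }) , (λ { refl → v₂∉S s∈S })) distinguishes)

  -- If edim(G) = n − 1, every pair of distinct vertices has a hub: otherwise
  -- V ∖ {v₁, v₂} would be a smaller generator.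
  edim⇒all-hubs : EdimIs G (n ∸ 1) → ∀ v₁ v₂ → v₁ ≢ v₂ → Hub v₁ v₂
  edim⇒all-hubs (_ , minimal) v₁ v₂ v₁≢v₂ with hub? v₁ v₂
  ... | yes hub = hub
  ... | no no-hub = ⊥-elim
        (<⇒≱ (∣∁⁅v₁,v₂⁆∣<n∸1 v₁≢v₂) (minimal _ (no-hub-generates no-hub)))

-- edim(G) ≤ n − 1 (the empty graph has no edges, so ⊥ generates).
generator-of-size-n∸1 : ∀ {n} (G : Graph n) → ∃[ S ] (IsEdgeMetricGenerator G S × ∣ S ∣ ≡ n ∸ 1)
generator-of-size-n∸1 {zero} G = ⊥ , (λ { (() , _) }) , refl
generator-of-size-n∸1 {suc _} G = ∁ ⁅ zero ⁆ , all-but-one-generates G zero , ∣∁⁅v⁆∣≡n∸1 zero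

theorem2p2 : ∀ {n : ℕ} (G : Graph n) → Connected G →
    EdimIs G (n ∸ 1) ⇔
    (∀ (v₁ v₂ : Fin n) → v₁ ≢ v₂ →
      ∃[ u ] (Adj G v₁ u × Adj G v₂ u ×
        (∀ w → NonMutualNeighbour G v₁ v₂ w → Adj G u w)))
theorem2p2 G connected =
  mk⇔ (edim⇒all-hubs G)
      (λ hubs → generator-of-size-n∸1 G , all-hubs⇒lower-bound G connected hubs)
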